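{- Let $\Gamma$ be a finite connected simple graph, let $A$ be a finite abelian group written as $A=\prod_{p\in I}A^{(p)}$, where $I$ is a finite set of primes and $A^{(p)}$ is the Sylow $p$-subgroup of $A$, and let $q^{(p)}:A\to A^{(p)}$ be the projections. Let $\phi:\mathrm{Ar}(\Gamma)\to A$ be a voltage assignment such that the covering $\Gamma\times_{\phi}A$ is connected, and for each $p\in I$ put $\phi^{(p)}=q^{(p)}\circ\phi$. Then $\Gamma\times_{\phi}A$ is the fibered product of the coverings $\Gamma\times_{\phi^{(p)}}A^{(p)}$, $p\in I$; and an automorphism $\alpha\in\mathrm{Aut}(\Gamma)$ can be lifted to $\Gamma\times_{\phi}A$ if and only if, for every $p\in I$, $\alpha$ can be lifted to $\Gamma\times_{\phi^{(p)}}A^{(p)}$.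
   Context: For a graph $\Gamma$, $\mathrm{Ar}(\Gamma)$ is its set of arcs (ordered pairs $(u,v)$ with $\{u,v\}$ an edge), and $(u,v)^{ -1}=(v,u)$. A voltage assignment in an abelian group $A$ is a map $\phi:\mathrm{Ar}(\Gamma)\to A$ with $\phi(x^{ -1})=-\phi(x)$. The covering $\Gamma\times_{\phi}A$ has vertex set $V(\Gamma)\times A$ and edges $\{(u,g),(v,\phi(u,v)+g)\}$ for $\{u,v\}\in E(\Gamma)$, $g\in A$, with covering map the projection to $V(\Gamma)$. Given voltage assignments $\phi_i:\mathrm{Ar}(\Gamma)\to A_i$ ($1\le i\le m$), their product $\phi=\prod\phi_i:\mathrm{Ar}(\Gamma)\to\prod A_i$, $\phi(x)=(\phi_1(x),\dots,\phi_m(x))$, and $\Gamma\times_\phi\prod A_i$ is called the fibered product of the coverings $\Gamma\times_{\phi_i}A_i$. For a covering $\pi:\Lambda\to\Gamma$, an automorphism $\alpha$ of $\Gamma$ is said to lift to $\Lambda$ if there is an automorphism $\tilde\alpha$ of $\Lambda$ with $\pi\circ\tilde\alpha=\alpha\circ\pi$. -}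

module Defs where

open import Level using (0ℓ)
open import Data.Nat using (ℕ; zero; suc; _+_; _*_; _^_)
open import Data.Nat.Properties using (^-distribˡ-+-*; *-comm)
open import Data.Nat.Primality using (Prime)
open import Data.Fin using (Fin)
open import Data.Fin.Permutation using (Permutation′; _⟨$⟩ʳ_)
open import Data.Bool using (Bool; T)
open import Data.Product using (Σ; ∃; _×_; _,_; proj₁; proj₂)
open import Data.List using (List)
open import Data.List.Relation.Unary.Any using (Any)
open import Function.Definitions using (Injective)
open import Relation.Binary.PropositionalEquality as ≡ using (_≡_)
open import Relation.Binary.Construct.Closure.ReflexiveTransitive using (Star)
open import Algebra.Bundles using (AbelianGroup; RawGroup)
import Algebra.Definitions.RawMonoid as RM
import Algebra.Properties.Monoid.Mult as MM
import Algebra.Properties.CommutativeMonoid.Mult as CMM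
import Algebra.Properties.AbelianGroup as AGP
import Relation.Binary.Reasoning.Setoid as SR

record Graph : Set where
  field
    n       : ℕ
    adj     : Fin n → Fin n → Bool
    adj-sym : ∀ u v → adj u v ≡ adj v u
    irrefl  : ∀ u → adj u u ≡ Data.Bool.false

open Graph public

Connected : Graph → Set
Connected Γ = ∀ u v → Star (λ a b → T (adj Γ a b)) u v

IsAut : (Γ : Graph) → Permutation′ (n Γ) → Set
IsAut Γ σ = ∀ u v → adj Γ (σ ⟨$⟩ʳ u) (σ ⟨$⟩ʳ v) ≡ adj Γ u v

-- Voltage assignments φ : Ar(Γ) → G (values of φ u v are only relevant
-- when (u,v) is an arc) and the derived covering graphs

IsVoltage : (Γ : Graph) (G : RawGroup 0ℓ 0ℓ) → (Fin (n Γ) → Fin (n Γ) → RawGroup.Carrier G) → Set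
IsVoltage Γ G φ = ∀ u v → T (adj Γ u v) → φ v u ≈ (φ u v) ⁻¹
  where open RawGroup G

record SGraph : Set₁ where
  field
    Vtx : Set
    _≃_ : Vtx → Vtx → Set
    Adj : Vtx → Vtx → Set

Cover : (Γ : Graph) (G : RawGroup 0ℓ 0ℓ) → (Fin (n Γ) → Fin (n Γ) → RawGroup.Carrier G) → SGraph
Cover Γ G φ = record
  { Vtx = Fin (n Γ) × Carrier
  ; _≃_ = λ x y → proj₁ x ≡ proj₁ y × proj₂ x ≈ proj₂ y
  ; Adj = λ x y → T (adj Γ (proj₁ x) (proj₁ y)) × proj₂ y ≈ φ (proj₁ x) (proj₁ y) ∙ proj₂ x
  }
  where open RawGroup G

SConnected : SGraph → Set
SConnected G = ∀ x y → ∃ λ z → Star Adj x z × z ≃ y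
  where open SGraph G

IsGraphIso : (G H : SGraph) → (SGraph.Vtx G → SGraph.Vtx H) → Set
IsGraphIso G H f =
  (∀ {x y} → x ≃G y → f x ≃H f y) ×
  (∀ x y → AdjG x y → AdjH (f x) (f y)) ×
  (∀ x y → AdjH (f x) (f y) → AdjG x y) ×
  Σ (Vtx H → Vtx G) λ g →
    (∀ {x y} → x ≃H y → g x ≃G g y) ×
    (∀ x → f (g x) ≃H x) × (∀ x → g (f x) ≃G x)
  where
  open SGraph
  _≃G_ = _≃_ G
  _≃H_ = _≃_ H
  AdjG = Adj G
  AdjH = Adj H

Lifts : (Γ : Graph) (σ : Permutation′ (n Γ)) (G : RawGroup 0ℓ 0ℓ)
        (φ : Fin (n Γ) → Fin (n Γ) → RawGroup.Carrier G) → Set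
Lifts Γ σ G φ =
  Σ (SGraph.Vtx (Cover Γ G φ) → SGraph.Vtx (Cover Γ G φ)) λ f →
    IsGraphIso (Cover Γ G φ) (Cover Γ G φ) f ×
    (∀ x → proj₁ (f x) ≡ σ ⟨$⟩ʳ proj₁ x)

ΠGroup : ∀ {m} → (Fin m → RawGroup 0ℓ 0ℓ) → RawGroup 0ℓ 0ℓ
ΠGroup Gs = record
  { Carrier = (i : Fin _) → RawGroup.Carrier (Gs i)
  ; _≈_     = λ g h → ∀ i → RawGroup._≈_ (Gs i) (g i) (h i)
  ; _∙_     = λ g h i → RawGroup._∙_ (Gs i) (g i) (h i)
  ; ε       = λ i → RawGroup.ε (Gs i)
  ; _⁻¹     = λ g i → RawGroup._⁻¹ (Gs i) (g i)
  }

module _ (A : AbelianGroup 0ℓ 0ℓ) where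
  open AbelianGroup A
  open RM rawMonoid using () renaming (_×_ to _·_)

  IsFinite : Set
  IsFinite = ∃ λ (xs : List Carrier) → ∀ a → Any (a ≈_) xs

  InSylow : ℕ → Carrier → Set
  InSylow p a = ∃ λ k → (p ^ k) · a ≈ ε

  private
    ×-ε : ∀ k → k · ε ≈ ε
    ×-ε zero = refl
    ×-ε (suc k) = trans (identityˡ _) (×-ε k)

    ×-⁻¹ : ∀ k a → k · (a ⁻¹) ≈ (k · a) ⁻¹
    ×-⁻¹ zero a = sym ε⁻¹≈ε
      where open import Algebra.Properties.Group group using (ε⁻¹≈ε)
    ×-⁻¹ (suc k) a = trans (∙-congˡ (×-⁻¹ k a)) (AGP.⁻¹-∙-comm A a (k · a))

    kill : ∀ p k l a → (p ^ k) · a ≈ ε → (p ^ l * p ^ k) · a ≈ ε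
    kill p k l a e = begin
        (p ^ l * p ^ k) · a   ≈⟨ sym (MM.×-assocˡ monoid a (p ^ l) (p ^ k)) ⟩
        (p ^ l) · ((p ^ k) · a) ≈⟨ MM.×-congʳ monoid (p ^ l) e ⟩
        (p ^ l) · ε ≈⟨ ×-ε (p ^ l) ⟩
        ε ∎
      where open SR setoid

  Sylow : ℕ → RawGroup 0ℓ 0ℓ
  Sylow p = record
    { Carrier = Σ Carrier (InSylow p)
    ; _≈_     = λ x y → proj₁ x ≈ proj₁ y
    ; _∙_     = λ { (a , k , ea) (b , l , eb) → (a ∙ b) , (k + l) ,
                   (begin
                     (p ^ (k + l)) · (a ∙ b) ≡⟨ ≡.cong (_· (a ∙ b)) (^-distribˡ-+-* p k l) ⟩
                     (p ^ k * p ^ l) · (a ∙ b) ≈⟨ CMM.×-distrib-+ commutativeMonoid a b (p ^ k * p ^ l) ⟩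
                     (p ^ k * p ^ l) · a ∙ (p ^ k * p ^ l) · b
                       ≡⟨ ≡.cong (λ t → t · a ∙ (p ^ k * p ^ l) · b) (*-comm (p ^ k) (p ^ l)) ⟩
                     (p ^ l * p ^ k) · a ∙ (p ^ k * p ^ l) · b
                       ≈⟨ ∙-cong (kill p k l a ea) (kill p l k b eb) ⟩
                     ε ∙ ε ≈⟨ identityˡ ε ⟩
                     ε ∎) }
    ; ε       = ε , 0 , identityˡ ε
    ; _⁻¹     = λ { (a , k , ea) → (a ⁻¹) , k ,
                   trans (×-⁻¹ (p ^ k) a) (trans (⁻¹-cong ea) ε⁻¹≈ε) }
    }
    where
    open SR setoid
    open import Algebra.Properties.Group group using (ε⁻¹≈ε)

  rawA : RawGroup 0ℓ 0ℓ
  rawA = rawGroup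

  -- decomposition data: distinct primes I(i), i ∈ Fin m, and maps
  -- q i : A → A^(I i) with a = Σ_i q i a  (so A = Π_i A^(I i) and the
  -- q i are the projections onto the factors)
  IsSylowDecomposition : ∀ {m} (I : Fin m → ℕ) (q : (i : Fin m) → Carrier → Carrier) → Set
  IsSylowDecomposition {m} I q =
    (∀ i → Prime (I i)) × Injective _≡_ _≡_ I ×
    (∀ i a → InSylow (I i) (q i a)) ×
    (∀ a → a ≈ RM.sum rawMonoid (λ i → q i a))

  sylowVoltage : ∀ {m} {I : Fin m → ℕ} {q : (i : Fin m) → Carrier → Carrier} →
    IsSylowDecomposition I q → {V : Set} → (V → V → Carrier) →
    (i : Fin m) → V → V → RawGroup.Carrier (Sylow (I i))
  sylowVoltage {q = q} dec φ i u v = q i (φ u v) , proj₁ (proj₂ (proj₂ dec)) i (φ u v)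

  sylowIdentification : ∀ {m} {I : Fin m → ℕ} {q : (i : Fin m) → Carrier → Carrier} →
    IsSylowDecomposition I q → {V : Set} →
    V × Carrier → V × RawGroup.Carrier (ΠGroup (λ i → Sylow (I i)))
  sylowIdentification {q = q} dec (v , a) = v , λ i → q i a , proj₁ (proj₂ (proj₂ dec)) i a

-- Elements of Sylow subgroups for distinct primes have coprime orders, so by Bézout a sum of
-- elements of the A^(p) vanishes only if every term does; hence the q i are endomorphisms and
-- a ↦ (q i a)ᵢ identifies Γ ×_φ A with the fibred product. Lifts of α to the Sylow coverings
-- combine componentwise into a lift to Γ ×_φ A. Conversely, let F lift α to the connected covering
-- Γ ×_φ A. The displacement F(v, b a) F(v, a)⁻¹ is unchanged along edges, hence constant, so on
-- each fibre F(v, b a) = θ_v(b) F(v, a) for an endomorphism θ_v of A. Endomorphisms commute with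
-- the q i, so q i ∘ F only depends on the A^(p)-component and induces a lift to Γ ×_{φ^(p)} A^(p).

module Submission where

open import Defs
open import Level using (0ℓ)
open import Data.Nat using (ℕ; zero; suc; _*_; _^_; nonTrivial⇒≢1)
open import Data.Nat.Primality using (Prime; prime⇒irreducible; prime⇒nonTrivial)
open import Data.Nat.Coprimality using (Coprime; coprime-Bézout)
open import Data.Nat.GCD using (module Bézout)
open import Data.Fin using (Fin; zero; suc; punchIn)
open import Data.Fin.Permutation as Permutation using (Permutation′; _⟨$⟩ʳ_; _⟨$⟩ˡ_)
open import Data.Fin.Properties using (punchInᵢ≢i)
open import Data.Product using (_,_; _×_; proj₁; proj₂)
open import Data.Bool using (T)
open import Relation.Binary.Construct.Closure.ReflexiveTransitive as Star using (Star; _◅_)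
open import Data.Sum using (inj₁; inj₂)
open import Data.Vec.Functional using (removeAt)
open import Function using (_∘_)
open import Function.Bundles using (_⇔_; mk⇔)
open import Function.Definitions using (Injective)
open import Relation.Nullary using (contradiction)
open import Relation.Binary.PropositionalEquality as ≡ using (_≡_; _≢_)
open import Algebra.Bundles using (AbelianGroup; Group; RawGroup)
open import Algebra.Structures using (IsMagma)
import Algebra.Definitions.RawMonoid as RawMonoidDefinitions
import Algebra.Properties.CommutativeMonoid.Mult as CommutativeMonoidMult
import Algebra.Properties.CommutativeMonoid.Sum as CommutativeMonoidSum
import Algebra.Properties.Group as GroupProperties
import Algebra.Properties.AbelianGroup as AbelianGroupProperties
import Algebra.Properties.CommutativeSemigroup as CommutativeSemigroupProperties
import Relation.Binary.Reasoning.Setoid as SetoidReasoning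

distinct-primes⇒coprime : ∀ {p r} → Prime p → Prime r → p ≢ r → Coprime p r
distinct-primes⇒coprime pp pr p≢r (d∣p , d∣r) with prime⇒irreducible pp d∣p
... | inj₁ d≡1 = d≡1
... | inj₂ ≡.refl with prime⇒irreducible pr d∣r
...   | inj₁ p≡1 = contradiction p≡1 (nonTrivial⇒≢1 {{prime⇒nonTrivial pp}})
...   | inj₂ p≡r = contradiction p≡r p≢r

module Torsion (A : AbelianGroup 0ℓ 0ℓ) where
  open AbelianGroup A
  open RawMonoidDefinitions rawMonoid using (sum) renaming (_×_ to _·_)
  open CommutativeMonoidMult commutativeMonoid using (×-congʳ; ×-distrib-+; ×-assocˡ)
  open CommutativeMonoidSum commutativeMonoid
    using (sum-remove; sum-cong-≋; sum-replicate-zero; ∑-distrib-+)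
  open GroupProperties group using (∙-cancelˡ; inverseˡ-unique; x∙y⁻¹≈ε⇒x≈y; x≈y⇒x∙y⁻¹≈ε)
  open AbelianGroupProperties A using (⁻¹-∙-comm)
  open CommutativeSemigroupProperties commutativeSemigroup using (interchange)
  open Group group using (_//_)
  open SetoidReasoning setoid

  record IsEndomorphism (f : Carrier → Carrier) : Set where
    field
      cong : ∀ {a b} → a ≈ b → f a ≈ f b
      homo : ∀ a b → f (a ∙ b) ≈ f a ∙ f b

    ε-homo : f ε ≈ ε
    ε-homo = ∙-cancelˡ (f ε) (f ε) ε (begin
      f ε ∙ f ε  ≈⟨ homo ε ε ⟨
      f (ε ∙ ε)  ≈⟨ cong (identityˡ ε) ⟩
      f ε        ≈⟨ identityʳ (f ε) ⟨
      f ε ∙ ε    ∎)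

    ⁻¹-homo : ∀ a → f (a ⁻¹) ≈ f a ⁻¹
    ⁻¹-homo a = inverseˡ-unique (f (a ⁻¹)) (f a)
      (trans (sym (homo (a ⁻¹) a)) (trans (cong (inverseˡ a)) ε-homo))

    ·-homo : ∀ k a → f (k · a) ≈ k · f a
    ·-homo zero    a = ε-homo
    ·-homo (suc k) a = trans (homo a (k · a)) (∙-congˡ (·-homo k a))

    sum-homo : ∀ {n} (z : Fin n → Carrier) → f (sum z) ≈ sum (f ∘ z)
    sum-homo {zero}  z = ε-homo
    sum-homo {suc n} z = trans (homo (z zero) _) (∙-congˡ (sum-homo (z ∘ suc)))

    sylow-preserving : ∀ {p a} → InSylow A p a → InSylow A p (f a)
    sylow-preserving {p} {a} (k , pᵏa≈ε) =
      k , trans (sym (·-homo (p ^ k) a)) (trans (cong pᵏa≈ε) ε-homo)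

  ·-isEndomorphism : ∀ k → IsEndomorphism (k ·_)
  ·-isEndomorphism k = record { cong = ×-congʳ k ; homo = λ a b → ×-distrib-+ a b k }

  ⁻¹-isEndomorphism : IsEndomorphism _⁻¹
  ⁻¹-isEndomorphism = record { cong = ⁻¹-cong ; homo = λ a b → sym (⁻¹-∙-comm a b) }

  ·-ε : ∀ k → k · ε ≈ ε
  ·-ε k = IsEndomorphism.ε-homo (·-isEndomorphism k)

  ·-comm : ∀ k l a → k · (l · a) ≈ l · (k · a)
  ·-comm k l = IsEndomorphism.·-homo (·-isEndomorphism k) l

  ·-annihilates-*ˡ : ∀ k l {a} → l · a ≈ ε → (k * l) · a ≈ ε
  ·-annihilates-*ˡ k l {a} la≈ε = trans (sym (×-assocˡ a k l)) (trans (×-congʳ k la≈ε) (·-ε k))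

  record DisjointTorsion (k l : ℕ) : Set where
    constructor disjointTorsion
    field
      torsion-meet : ∀ {a} → k · a ≈ ε → l · a ≈ ε → a ≈ ε

  open DisjointTorsion

  ·-annihilates-suc : ∀ c {a} → c · a ≈ ε → suc c · a ≈ ε → a ≈ ε
  ·-annihilates-suc c {a} ca≈ε [1+c]a≈ε =
    trans (sym (identityʳ a)) (trans (∙-congˡ (sym ca≈ε)) [1+c]a≈ε)

  coprime⇒disjointTorsion : ∀ {k l} → Coprime k l → DisjointTorsion k l
  coprime⇒disjointTorsion {k} {l} k⊥l = disjointTorsion meet
    where
    meet : ∀ {a} → k · a ≈ ε → l · a ≈ ε → a ≈ ε
    meet {a} ka≈ε la≈ε with coprime-Bézout k⊥l
    ... | Bézout.+- u v eq = ·-annihilates-suc (v * l) (·-annihilates-*ˡ v l la≈ε)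
      (≡.subst (λ d → d · a ≈ ε) (≡.sym eq) (·-annihilates-*ˡ u k ka≈ε))
    ... | Bézout.-+ u v eq = ·-annihilates-suc (u * k) (·-annihilates-*ˡ u k ka≈ε)
      (≡.subst (λ d → d · a ≈ ε) (≡.sym eq) (·-annihilates-*ˡ v l la≈ε))

  disjointTorsion-sym : ∀ {k l} → DisjointTorsion k l → DisjointTorsion l k
  disjointTorsion-sym k⊥l = disjointTorsion λ la≈ε ka≈ε → torsion-meet k⊥l ka≈ε la≈ε

  disjointTorsion-*ʳ : ∀ {k l m} → DisjointTorsion k l → DisjointTorsion k m → DisjointTorsion k (l * m)
  disjointTorsion-*ʳ {k} {l} {m} k⊥l k⊥m = disjointTorsion λ {a} ka≈ε lma≈ε →
    torsion-meet k⊥m ka≈ε (torsion-meet k⊥l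
      (trans (·-comm k m a) (trans (×-congʳ m ka≈ε) (·-ε m)))
      (trans (×-assocˡ a l m) lma≈ε))

  disjointTorsion-^ʳ : ∀ {k l} → DisjointTorsion k l → ∀ e → DisjointTorsion k (l ^ e)
  disjointTorsion-^ʳ k⊥l zero    = disjointTorsion λ {a} _ 1a≈ε → trans (sym (identityʳ a)) 1a≈ε
  disjointTorsion-^ʳ k⊥l (suc e) = disjointTorsion-*ʳ k⊥l (disjointTorsion-^ʳ k⊥l e)

  disjointTorsion-^ : ∀ {k l} → DisjointTorsion k l → ∀ e f → DisjointTorsion (k ^ e) (l ^ f)
  disjointTorsion-^ k⊥l e f =
    disjointTorsion-sym (disjointTorsion-^ʳ (disjointTorsion-sym (disjointTorsion-^ʳ k⊥l f)) e)

  sylow-disjoint : ∀ {p r a} → Prime p → Prime r → p ≢ r →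
    InSylow A p a → InSylow A r a → a ≈ ε
  sylow-disjoint pp pr p≢r (e , pᵉa≈ε) (f , rᶠa≈ε) = torsion-meet
    (disjointTorsion-^ (coprime⇒disjointTorsion (distinct-primes⇒coprime pp pr p≢r)) e f)
    pᵉa≈ε rᶠa≈ε

  ∙-//-cancelˡ : ∀ c a b → (c ∙ a) // (c ∙ b) ≈ a // b
  ∙-//-cancelˡ c a b = begin
    (c ∙ a) ∙ (c ∙ b) ⁻¹        ≈⟨ ∙-congˡ (⁻¹-∙-comm c b) ⟨
    (c ∙ a) ∙ (c ⁻¹ ∙ b ⁻¹)     ≈⟨ interchange c a (c ⁻¹) (b ⁻¹) ⟩
    (c ∙ c ⁻¹) ∙ (a ∙ b ⁻¹)     ≈⟨ ∙-congʳ (inverseʳ c) ⟩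
    ε ∙ (a ∙ b ⁻¹)              ≈⟨ identityˡ _ ⟩
    a ∙ b ⁻¹                    ∎

  SylowFamily : ∀ {m} → (Fin m → ℕ) → (Fin m → Carrier) → Set
  SylowFamily I z = ∀ j → InSylow A (I j) (z j)

  sylow-∙ : ∀ {p a b} → InSylow A p a → InSylow A p b → InSylow A p (a ∙ b)
  sylow-∙ {p} {a} {b} a∈ b∈ = proj₂ (RawGroup._∙_ (Sylow A p) (a , a∈) (b , b∈))

  sylow-independent : ∀ {m p a} (I : Fin m → ℕ) (z : Fin m → Carrier) →
    Prime p → (∀ j → Prime (I j)) → (∀ j → p ≢ I j) →
    SylowFamily I z → InSylow A p a → a ∙ sum z ≈ ε → a ≈ ε
  sylow-independent {zero} {a = a} I z _ _ _ _ _ a∙ε≈ε = trans (sym (identityʳ a)) a∙ε≈ε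
  sylow-independent {suc m} {p} {a} I z pp pI p≢I z∈ a∈ a∙Σz≈ε with z∈ zero
  -- M = I 0 ^ e kills z 0 and keeps a in A^(p), so M · a ≈ ε by recursion on the other terms.
  ... | e , Mz₀≈ε = sylow-disjoint pp (pI zero) (p≢I zero) a∈ (e , Ma≈ε)
    where
    M : ℕ
    M = I zero ^ e
    open IsEndomorphism (·-isEndomorphism M)
    Ma≈ε : M · a ≈ ε
    Ma≈ε = sylow-independent (I ∘ suc) ((M ·_) ∘ z ∘ suc) pp (pI ∘ suc) (p≢I ∘ suc)
      (sylow-preserving ∘ z∈ ∘ suc) (sylow-preserving a∈) (begin
        M · a ∙ sum ((M ·_) ∘ z ∘ suc)        ≈⟨ ∙-congˡ (identityˡ _) ⟨
        M · a ∙ (ε ∙ sum ((M ·_) ∘ z ∘ suc))  ≈⟨ ∙-congˡ (∙-congʳ Mz₀≈ε) ⟨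
        M · a ∙ sum ((M ·_) ∘ z)              ≈⟨ ∙-congˡ (sum-homo z) ⟨
        M · a ∙ M · sum z                      ≈⟨ homo a (sum z) ⟨
        M · (a ∙ sum z)                        ≈⟨ cong a∙Σz≈ε ⟩
        M · ε                                  ≈⟨ ε-homo ⟩
        ε                                      ∎)

  sum-single : ∀ {m} (t : Fin m → Carrier) i → (∀ j → j ≢ i → t j ≈ ε) → sum t ≈ t i
  sum-single {suc m} t i off = begin
    sum t                     ≈⟨ sum-remove {i = i} t ⟩
    t i ∙ sum (removeAt t i)  ≈⟨ ∙-congˡ (sum-cong-≋ (λ j → off (punchIn i j) (punchInᵢ≢i i j))) ⟩
    t i ∙ sum {m} (λ _ → ε)   ≈⟨ ∙-congˡ (sum-replicate-zero m) ⟩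
    t i ∙ ε                   ≈⟨ identityʳ (t i) ⟩
    t i                       ∎

  sylow-components-trivial : ∀ {m} {I : Fin m → ℕ} →
    (∀ j → Prime (I j)) → Injective _≡_ _≡_ I → (z : Fin m → Carrier) →
    SylowFamily I z → sum z ≈ ε → ∀ i → z i ≈ ε
  sylow-components-trivial {suc m} {I} pI injI z z∈ Σz≈ε i =
    sylow-independent (removeAt I i) (removeAt z i) (pI i) (pI ∘ punchIn i)
      (λ j Iᵢ≡Iⱼ → punchInᵢ≢i i j (≡.sym (injI Iᵢ≡Iⱼ))) (z∈ ∘ punchIn i) (z∈ i)
      (trans (sym (sum-remove {i = i} z)) Σz≈ε)

  sylow-components-unique : ∀ {m} {I : Fin m → ℕ} →
    (∀ j → Prime (I j)) → Injective _≡_ _≡_ I → (x y : Fin m → Carrier) →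
    SylowFamily I x → SylowFamily I y → sum x ≈ sum y → ∀ i → x i ≈ y i
  sylow-components-unique pI injI x y x∈ y∈ Σx≈Σy i = x∙y⁻¹≈ε⇒x≈y (x i) (y i)
    (sylow-components-trivial pI injI (λ j → x j ∙ y j ⁻¹)
      (λ j → sylow-∙ (x∈ j) (sylow-preserving (y∈ j))) (begin
        sum (λ j → x j ∙ y j ⁻¹)  ≈⟨ ∑-distrib-+ x (_⁻¹ ∘ y) ⟩
        sum x ∙ sum (_⁻¹ ∘ y)     ≈⟨ ∙-congˡ (sum-homo y) ⟨
        sum x ∙ sum y ⁻¹          ≈⟨ x≈y⇒x∙y⁻¹≈ε Σx≈Σy ⟩
        ε                         ∎) i)
    where open IsEndomorphism ⁻¹-isEndomorphism

module SylowDecomposition (A : AbelianGroup 0ℓ 0ℓ) {m : ℕ} (I : Fin m → ℕ)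
  (q : Fin m → AbelianGroup.Carrier A → AbelianGroup.Carrier A)
  (dec : IsSylowDecomposition A I q) where
  open AbelianGroup A
  open RawMonoidDefinitions rawMonoid using (sum)
  open CommutativeMonoidSum commutativeMonoid using (sum-cong-≋; ∑-distrib-+)
  open Torsion A
  open Group group using (_//_)
  open GroupProperties group using (x≈y⇒x∙y⁻¹≈ε)
  open SetoidReasoning setoid

  I-prime : ∀ i → Prime (I i)
  I-prime = proj₁ dec

  I-injective : Injective _≡_ _≡_ I
  I-injective = proj₁ (proj₂ dec)

  q-sylow : ∀ i a → InSylow A (I i) (q i a)
  q-sylow = proj₁ (proj₂ (proj₂ dec))

  decomposition : ∀ a → a ≈ sum (λ i → q i a)
  decomposition = proj₂ (proj₂ (proj₂ dec))

  components-unique : (x y : Fin m → Carrier) → SylowFamily I x → SylowFamily I y →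
    sum x ≈ sum y → ∀ i → x i ≈ y i
  components-unique = sylow-components-unique I-prime I-injective

  ≈-by-components : ∀ {a b} → (∀ i → q i a ≈ q i b) → a ≈ b
  ≈-by-components {a} {b} qa≈qb =
    trans (decomposition a) (trans (sum-cong-≋ qa≈qb) (sym (decomposition b)))

  q-cong : ∀ i {a b} → a ≈ b → q i a ≈ q i b
  q-cong i {a} {b} a≈b = components-unique (λ j → q j a) (λ j → q j b) (λ j → q-sylow j a)
    (λ j → q-sylow j b) (trans (sym (decomposition a)) (trans a≈b (decomposition b))) i

  q-homo : ∀ i a b → q i (a ∙ b) ≈ q i a ∙ q i b
  q-homo i a b = components-unique (λ j → q j (a ∙ b)) (λ j → q j a ∙ q j b)
    (λ j → q-sylow j (a ∙ b)) (λ j → sylow-∙ (q-sylow j a) (q-sylow j b)) (begin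
      sum (λ j → q j (a ∙ b))            ≈⟨ decomposition (a ∙ b) ⟨
      a ∙ b                              ≈⟨ ∙-cong (decomposition a) (decomposition b) ⟩
      sum (λ j → q j a) ∙ sum (λ j → q j b) ≈⟨ ∑-distrib-+ (λ j → q j a) (λ j → q j b) ⟨
      sum (λ j → q j a ∙ q j b)          ∎) i

  q-isEndomorphism : ∀ i → IsEndomorphism (q i)
  q-isEndomorphism i = record { cong = q-cong i ; homo = q-homo i }

  q-sum : (x : Fin m → Carrier) → SylowFamily I x → ∀ i → q i (sum x) ≈ x i
  q-sum x x∈ = components-unique (λ j → q j (sum x)) x (λ j → q-sylow j (sum x)) x∈
    (sym (decomposition (sum x)))

  q-fix : ∀ i {a} → InSylow A (I i) a → q i a ≈ a
  q-fix i {a} a∈ = sym (trans (decomposition a) (sum-single (λ j → q j a) i q-off-diagonal))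
    where
    q-off-diagonal : ∀ j → j ≢ i → q j a ≈ ε
    q-off-diagonal j j≢i = sylow-disjoint (I-prime j) (I-prime i) (j≢i ∘ I-injective)
      (q-sylow j a) (IsEndomorphism.sylow-preserving (q-isEndomorphism j) a∈)

  q-idem : ∀ i a → q i (q i a) ≈ q i a
  q-idem i a = q-fix i (q-sylow i a)

  q-absorbs : ∀ i c a → q i (q i c ∙ a) ≈ q i (c ∙ a)
  q-absorbs i c a = begin
    q i (q i c ∙ a)          ≈⟨ q-homo i (q i c) a ⟩
    q i (q i c) ∙ q i a      ≈⟨ ∙-congʳ (q-idem i c) ⟩
    q i c ∙ q i a            ≈⟨ q-homo i c a ⟨
    q i (c ∙ a)              ∎

  q-//-≈ε : ∀ i {a b} → q i a ≈ q i b → q i (a // b) ≈ ε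
  q-//-≈ε i {a} {b} qa≈qb = trans (q-homo i a (b ⁻¹))
    (trans (∙-congˡ (IsEndomorphism.⁻¹-homo (q-isEndomorphism i) b)) (x≈y⇒x∙y⁻¹≈ε qa≈qb))

  q-commutes : ∀ i {f} → IsEndomorphism f → ∀ a → q i (f a) ≈ f (q i a)
  q-commutes i {f} f-endo a = begin
    q i (f a)                       ≈⟨ q-cong i (cong (decomposition a)) ⟩
    q i (f (sum (λ j → q j a)))     ≈⟨ q-cong i (sum-homo (λ j → q j a)) ⟩
    q i (sum (λ j → f (q j a)))     ≈⟨ q-sum (λ j → f (q j a)) (λ j → sylow-preserving (q-sylow j a)) i ⟩
    f (q i a)                       ∎
    where open IsEndomorphism f-endo

  sylowIdentification-isGraphIso : (Γ : Graph) (φ : Fin (n Γ) → Fin (n Γ) → Carrier) →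
    IsGraphIso (Cover Γ (rawA A) φ)
               (Cover Γ (ΠGroup (λ i → Sylow A (I i))) (λ u v i → sylowVoltage A dec φ i u v))
               (sylowIdentification A dec)
  sylowIdentification-isGraphIso Γ φ =
      (λ (u≡v , a≈b) → u≡v , λ i → q-cong i a≈b)
    , (λ (u , a) (v , b) (u~v , b≈φa) → u~v , λ i → trans (q-cong i b≈φa) (q-homo i (φ u v) a))
    , (λ (u , a) (v , b) (u~v , qb≈qφqa) → u~v ,
         ≈-by-components (λ i → trans (qb≈qφqa i) (sym (q-homo i (φ u v) a))))
    , (λ (v , x) → v , sum (proj₁ ∘ x))
    , (λ (u≡v , x≈y) → u≡v , sum-cong-≋ x≈y)
    , (λ (v , x) → ≡.refl , q-sum (proj₁ ∘ x) (proj₂ ∘ x))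
    , (λ (v , a) → ≡.refl , sym (decomposition a))

module CoverProperties (Γ : Graph) (G : RawGroup 0ℓ 0ℓ)
  (G-isMagma : IsMagma (RawGroup._≈_ G) (RawGroup._∙_ G))
  (ψ : Fin (n Γ) → Fin (n Γ) → RawGroup.Carrier G) where
  open RawGroup G using (_∙_)
  open IsMagma G-isMagma using (refl; sym; trans; ∙-congˡ)
  open SGraph (Cover Γ G ψ)

  ≃-sym : ∀ {x y} → x ≃ y → y ≃ x
  ≃-sym (u≡v , a≈b) = ≡.sym u≡v , sym a≈b

  Adj-resp : ∀ {x x′ y y′} → x ≃ x′ → y ≃ y′ → Adj x y → Adj x′ y′
  Adj-resp (≡.refl , a≈a′) (≡.refl , b≈b′) (u~v , b≈ψa) =
    u~v , trans (sym b≈b′) (trans b≈ψa (∙-congˡ a≈a′))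

  record IsCoverMap (F : Vtx → Vtx) (τ : Fin (n Γ) → Fin (n Γ)) : Set where
    field
      cong          : ∀ {x y} → x ≃ y → F x ≃ F y
      preserves-Adj : ∀ x y → Adj x y → Adj (F x) (F y)
      over          : ∀ x → proj₁ (F x) ≡ τ (proj₁ x)

  record InverseLifts (σ : Permutation′ (n Γ)) : Set where
    field
      lift             : Vtx → Vtx
      lift⁻¹           : Vtx → Vtx
      lift-isCoverMap  : IsCoverMap lift (σ ⟨$⟩ʳ_)
      lift⁻¹-isCoverMap : IsCoverMap lift⁻¹ (σ ⟨$⟩ˡ_)
      lift∘lift⁻¹      : ∀ x → lift (lift⁻¹ x) ≃ x
      lift⁻¹∘lift      : ∀ x → lift⁻¹ (lift x) ≃ x

  Lifts⇒InverseLifts : ∀ {σ} → Lifts Γ σ G ψ → InverseLifts σ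
  Lifts⇒InverseLifts {σ}
    (F , (F-cong , F-adj , F-reflect , F⁻¹ , F⁻¹-cong , F∘F⁻¹ , F⁻¹∘F) , F-over) = record
    { lift              = F
    ; lift⁻¹            = F⁻¹
    ; lift-isCoverMap   = record { cong = F-cong ; preserves-Adj = F-adj ; over = F-over }
    ; lift⁻¹-isCoverMap = record { cong = F⁻¹-cong ; preserves-Adj = F⁻¹-adj ; over = F⁻¹-over }
    ; lift∘lift⁻¹       = F∘F⁻¹
    ; lift⁻¹∘lift       = F⁻¹∘F
    }
    where
    F⁻¹-adj : ∀ x y → Adj x y → Adj (F⁻¹ x) (F⁻¹ y)
    F⁻¹-adj x y x~y =
      F-reflect (F⁻¹ x) (F⁻¹ y) (Adj-resp (≃-sym (F∘F⁻¹ x)) (≃-sym (F∘F⁻¹ y)) x~y)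

    F⁻¹-over : ∀ x → proj₁ (F⁻¹ x) ≡ σ ⟨$⟩ˡ proj₁ x
    F⁻¹-over x = begin
      proj₁ (F⁻¹ x)                        ≡⟨ Permutation.inverseˡ σ ⟨
      σ ⟨$⟩ˡ (σ ⟨$⟩ʳ proj₁ (F⁻¹ x))        ≡⟨ ≡.cong (σ ⟨$⟩ˡ_) (F-over (F⁻¹ x)) ⟨
      σ ⟨$⟩ˡ proj₁ (F (F⁻¹ x))             ≡⟨ ≡.cong (σ ⟨$⟩ˡ_) (proj₁ (F∘F⁻¹ x)) ⟩
      σ ⟨$⟩ˡ proj₁ x                       ∎
      where open ≡.≡-Reasoning

  InverseLifts⇒Lifts : ∀ {σ} → InverseLifts σ → Lifts Γ σ G ψ
  InverseLifts⇒Lifts L =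
    lift , (cong , preserves-Adj , reflects-Adj , lift⁻¹ , IsCoverMap.cong lift⁻¹-isCoverMap ,
            lift∘lift⁻¹ , lift⁻¹∘lift) , over
    where
    open InverseLifts L
    open IsCoverMap lift-isCoverMap
    reflects-Adj : ∀ x y → Adj (lift x) (lift y) → Adj x y
    reflects-Adj x y Fx~Fy = Adj-resp (lift⁻¹∘lift x) (lift⁻¹∘lift y)
      (IsCoverMap.preserves-Adj lift⁻¹-isCoverMap (lift x) (lift y) Fx~Fy)

module Displacement (A : AbelianGroup 0ℓ 0ℓ) (Γ : Graph)
  (ψ : Fin (n Γ) → Fin (n Γ) → AbelianGroup.Carrier A)
  (connected : SConnected (Cover Γ (rawA A) ψ))
  {F : SGraph.Vtx (Cover Γ (rawA A) ψ) → SGraph.Vtx (Cover Γ (rawA A) ψ)} {τ : Fin (n Γ) → Fin (n Γ)}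
  (F-isCoverMap : CoverProperties.IsCoverMap Γ (rawA A) (AbelianGroup.isMagma A) ψ F τ) where
  open AbelianGroup A
  open Torsion A using (IsEndomorphism; ∙-//-cancelˡ)
  open Group group using (_//_)
  open GroupProperties group using (∙-cancelʳ; //-rightDividesˡ)
  open CommutativeSemigroupProperties commutativeSemigroup using (x∙yz≈y∙xz)
  open CoverProperties Γ (rawA A) isMagma ψ
  open SGraph (Cover Γ (rawA A) ψ)
  open SetoidReasoning setoid

  open IsCoverMap F-isCoverMap

  fibre : Fin (n Γ) → Carrier → Carrier
  fibre v a = proj₂ (F (v , a))

  fibre-cong : ∀ v {a b} → a ≈ b → fibre v a ≈ fibre v b
  fibre-cong v a≈b = proj₂ (cong (≡.refl , a≈b))

  fibre-adj : ∀ {u v} a → T (adj Γ u v) →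
    T (adj Γ (τ u) (τ v)) × fibre v (ψ u v ∙ a) ≈ ψ (τ u) (τ v) ∙ fibre u a
  fibre-adj {u} {v} a u~v with preserves-Adj (u , a) (v , ψ u v ∙ a) (u~v , refl)
  ... | Fu~Fv , Fv≈ψFu rewrite over (u , a) | over (v , ψ u v ∙ a) = Fu~Fv , Fv≈ψFu

  displacement : Vtx → Carrier → Carrier
  displacement (v , a) b = fibre v (b ∙ a) // fibre v a

  displacement-adj : ∀ x y → Adj x y → ∀ b → displacement y b ≈ displacement x b
  displacement-adj (u , a) (v , c) (u~v , c≈ψa) b = begin
    fibre v (b ∙ c) // fibre v c
      ≈⟨ //-cong (fibre-cong v (trans (∙-congˡ c≈ψa) (x∙yz≈y∙xz b _ a))) (fibre-cong v c≈ψa) ⟩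
    fibre v (ψ u v ∙ (b ∙ a)) // fibre v (ψ u v ∙ a)
      ≈⟨ //-cong (proj₂ (fibre-adj (b ∙ a) u~v)) (proj₂ (fibre-adj a u~v)) ⟩
    (ψ (τ u) (τ v) ∙ fibre u (b ∙ a)) // (ψ (τ u) (τ v) ∙ fibre u a)
      ≈⟨ ∙-//-cancelˡ _ _ _ ⟩
    fibre u (b ∙ a) // fibre u a ∎
    where
    //-cong : ∀ {a a′ b b′} → a ≈ a′ → b ≈ b′ → a // b ≈ a′ // b′
    //-cong a≈a′ b≈b′ = ∙-cong a≈a′ (⁻¹-cong b≈b′)

  displacement-constant : ∀ x y b → displacement x b ≈ displacement y b
  displacement-constant x y b with connected x y
  ... | z , x⇝z , (≡.refl , c≈d) =
    trans (along x⇝z) (∙-cong (fibre-cong _ (∙-congˡ c≈d)) (⁻¹-cong (fibre-cong _ c≈d)))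
    where
    along : ∀ {x z} → Star Adj x z → displacement x b ≈ displacement z b
    along Star.ε    = refl
    along (x~y ◅ p) = trans (sym (displacement-adj _ _ x~y b)) (along p)

  -- On the fibre over w, F conjugates the translation by b into the translation by θ w b.
  θ : Fin (n Γ) → Carrier → Carrier
  θ w b = fibre w b // fibre w ε

  fibre-translate : ∀ w a b → fibre w (b ∙ a) ≈ θ w b ∙ fibre w a
  fibre-translate w a b = begin
    fibre w (b ∙ a)                     ≈⟨ //-rightDividesˡ (fibre w a) _ ⟨
    displacement (w , a) b ∙ fibre w a  ≈⟨ ∙-congʳ (displacement-constant (w , a) (w , ε) b) ⟩
    displacement (w , ε) b ∙ fibre w a  ≈⟨ ∙-congʳ (∙-congʳ (fibre-cong w (identityʳ b))) ⟩
    θ w b ∙ fibre w a                   ∎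

  θ-isEndomorphism : ∀ w → IsEndomorphism (θ w)
  θ-isEndomorphism w = record
    { cong = λ b≈b′ → ∙-congʳ (fibre-cong w b≈b′)
    ; homo = λ b b′ → ∙-cancelʳ (fibre w ε) _ _ (begin
        θ w (b ∙ b′) ∙ fibre w ε          ≈⟨ fibre-translate w ε (b ∙ b′) ⟨
        fibre w ((b ∙ b′) ∙ ε)            ≈⟨ fibre-cong w (assoc b b′ ε) ⟩
        fibre w (b ∙ (b′ ∙ ε))            ≈⟨ fibre-translate w (b′ ∙ ε) b ⟩
        θ w b ∙ fibre w (b′ ∙ ε)          ≈⟨ ∙-congˡ (fibre-translate w ε b′) ⟩
        θ w b ∙ (θ w b′ ∙ fibre w ε)      ≈⟨ assoc _ _ _ ⟨
        (θ w b ∙ θ w b′) ∙ fibre w ε      ∎)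
    }

module _ {Γ : Graph} {σ : Permutation′ (n Γ)} (σ-aut : IsAut Γ σ) where

  aut-preserves-adj : ∀ {u v} → T (adj Γ u v) → T (adj Γ (σ ⟨$⟩ʳ u) (σ ⟨$⟩ʳ v))
  aut-preserves-adj {u} {v} = ≡.subst T (≡.sym (σ-aut u v))

  aut⁻¹-preserves-adj : ∀ {u v} → T (adj Γ u v) → T (adj Γ (σ ⟨$⟩ˡ u) (σ ⟨$⟩ˡ v))
  aut⁻¹-preserves-adj {u} {v} = ≡.subst T (σ-aut (σ ⟨$⟩ˡ u) (σ ⟨$⟩ˡ v))
    ∘ ≡.subst T (≡.sym (≡.cong₂ (adj Γ) (Permutation.inverseʳ σ) (Permutation.inverseʳ σ)))

module SylowLifts (A : AbelianGroup 0ℓ 0ℓ) {m : ℕ} (I : Fin m → ℕ)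
  (q : Fin m → AbelianGroup.Carrier A → AbelianGroup.Carrier A)
  (dec : IsSylowDecomposition A I q)
  (Γ : Graph) (φ : Fin (n Γ) → Fin (n Γ) → AbelianGroup.Carrier A) where
  open AbelianGroup A
  open RawMonoidDefinitions rawMonoid using (sum)
  open CommutativeMonoidSum commutativeMonoid using (sum-cong-≋; ∑-distrib-+)
  open Torsion A using (IsEndomorphism)
  open SylowDecomposition A I q dec
  open Group group using (_//_)
  open GroupProperties group using (//-rightDividesˡ)
  open SetoidReasoning setoid

  sylow-isMagma : ∀ p → IsMagma (RawGroup._≈_ (Sylow A p)) (RawGroup._∙_ (Sylow A p))
  sylow-isMagma p = record
    { isEquivalence = record { refl = refl ; sym = sym ; trans = trans }
    ; ∙-cong        = ∙-cong
    }

  φ[_] : (i : Fin m) → Fin (n Γ) → Fin (n Γ) → RawGroup.Carrier (Sylow A (I i))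
  φ[ i ] = sylowVoltage A dec φ i

  module Cov = CoverProperties Γ (rawA A) isMagma φ
  module Covᵢ (i : Fin m) = CoverProperties Γ (Sylow A (I i)) (sylow-isMagma (I i)) φ[ i ]
  open SGraph (Cover Γ (rawA A) φ) using (Vtx; _≃_)

  Vtxᵢ : Fin m → Set
  Vtxᵢ i = SGraph.Vtx (Cover Γ (Sylow A (I i)) φ[ i ])

  _≃ᵢ_ : ∀ {i} → Vtxᵢ i → Vtxᵢ i → Set
  _≃ᵢ_ {i} = SGraph._≃_ (Cover Γ (Sylow A (I i)) φ[ i ])

  project : ∀ i → Vtx → Vtxᵢ i
  project i (v , a) = v , q i a , q-sylow i a

  label : ∀ {i} → Vtxᵢ i → Carrier
  label (v , a , a∈) = a

  sylowMap : ∀ i → (Vtx → Vtx) → (Fin (n Γ) → Fin (n Γ)) → Vtxᵢ i → Vtxᵢ i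
  sylowMap i F τ (v , a , _) = τ v , q i (proj₂ (F (v , a))) , q-sylow i _

  module _ (connected : SConnected (Cover Γ (rawA A) φ)) (i : Fin m) where

    q-fibre-cong : ∀ {F τ} (F-isCoverMap : Cov.IsCoverMap F τ) w {a b} → q i a ≈ q i b →
      q i (proj₂ (F (w , a))) ≈ q i (proj₂ (F (w , b)))
    q-fibre-cong F-isCoverMap w {a} {b} qa≈qb = begin
      q i (fibre w a)                       ≈⟨ q-cong i (fibre-cong w (//-rightDividesˡ b a)) ⟨
      q i (fibre w ((a // b) ∙ b))          ≈⟨ q-cong i (fibre-translate w b (a // b)) ⟩
      q i (θ w (a // b) ∙ fibre w b)        ≈⟨ q-homo i _ _ ⟩
      q i (θ w (a // b)) ∙ q i (fibre w b)  ≈⟨ ∙-congʳ q-θ≈ε ⟩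
      ε ∙ q i (fibre w b)                   ≈⟨ identityˡ _ ⟩
      q i (fibre w b)                       ∎
      where
      open Displacement A Γ φ connected F-isCoverMap
      open IsEndomorphism (θ-isEndomorphism w) using (cong; ε-homo)
      q-θ≈ε : q i (θ w (a // b)) ≈ ε
      q-θ≈ε = trans (q-commutes i (θ-isEndomorphism w) (a // b))
                    (trans (cong (q-//-≈ε i qa≈qb)) ε-homo)

    sylowMap-isCoverMap : ∀ {F τ} → Cov.IsCoverMap F τ → Covᵢ.IsCoverMap i (sylowMap i F τ) τ
    sylowMap-isCoverMap {F} {τ} F-isCoverMap = record
      { cong          = λ (u≡v , a≈b) → ≡.cong τ u≡v , q-cong i (proj₂ (F-cong (u≡v , a≈b)))
      ; preserves-Adj = λ (u , a , _) (v , b , _) (u~v , b≈φa) → proj₁ (fibre-adj a u~v) , (begin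
          q i (fibre v b)
            ≈⟨ q-fibre-cong F-isCoverMap v (trans (q-cong i b≈φa) (q-absorbs i _ a)) ⟩
          q i (fibre v (φ u v ∙ a))              ≈⟨ q-cong i (proj₂ (fibre-adj a u~v)) ⟩
          q i (φ (τ u) (τ v) ∙ fibre u a)        ≈⟨ q-homo i _ _ ⟩
          q i (φ (τ u) (τ v)) ∙ q i (fibre u a)  ∎)
      ; over          = λ _ → ≡.refl
      }
      where
      open Displacement A Γ φ connected F-isCoverMap
      open Cov.IsCoverMap F-isCoverMap using () renaming (cong to F-cong)

    sylowMap-inverse : ∀ {F G τ τ′} → Cov.IsCoverMap F τ → Cov.IsCoverMap G τ′ →
      (∀ v → τ′ (τ v) ≡ v) → (∀ x → G (F x) ≃ x) →
      ∀ y → sylowMap i G τ′ (sylowMap i F τ y) ≃ᵢ y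
    sylowMap-inverse {F} {G} F-isCoverMap G-isCoverMap τ′∘τ G∘F (v , a , a∈) = τ′∘τ v , (begin
      q i (proj₂ (G (_ , q i (proj₂ (F (v , a))))))  ≈⟨ q-fibre-cong G-isCoverMap _ (q-idem i _) ⟩
      q i (proj₂ (G (_ , proj₂ (F (v , a)))))
        ≈⟨ q-cong i (proj₂ (G-cong (≡.sym (F-over (v , a)) , refl))) ⟩
      q i (proj₂ (G (F (v , a))))                    ≈⟨ q-cong i (proj₂ (G∘F (v , a))) ⟩
      q i a                                          ≈⟨ q-fix i a∈ ⟩
      a                                              ∎)
      where
      open Cov.IsCoverMap F-isCoverMap using () renaming (over to F-over)
      open Cov.IsCoverMap G-isCoverMap using () renaming (cong to G-cong)

  lift-to-sylow : SConnected (Cover Γ (rawA A) φ) → ∀ {σ} → Lifts Γ σ (rawA A) φ →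
    ∀ i → Lifts Γ σ (Sylow A (I i)) φ[ i ]
  lift-to-sylow connected {σ} L i = Covᵢ.InverseLifts⇒Lifts i {σ} record
    { lift              = sylowMap i lift (σ ⟨$⟩ʳ_)
    ; lift⁻¹            = sylowMap i lift⁻¹ (σ ⟨$⟩ˡ_)
    ; lift-isCoverMap   = sylowMap-isCoverMap connected i lift-isCoverMap
    ; lift⁻¹-isCoverMap = sylowMap-isCoverMap connected i lift⁻¹-isCoverMap
    ; lift∘lift⁻¹       = sylowMap-inverse connected i lift⁻¹-isCoverMap lift-isCoverMap
                            (λ _ → Permutation.inverseʳ σ) lift∘lift⁻¹
    ; lift⁻¹∘lift       = sylowMap-inverse connected i lift-isCoverMap lift⁻¹-isCoverMap
                            (λ _ → Permutation.inverseˡ σ) lift⁻¹∘lift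
    }
    where open Cov.InverseLifts (Cov.Lifts⇒InverseLifts {σ} L)

  combine : (∀ i → Vtxᵢ i → Vtxᵢ i) → (Fin (n Γ) → Fin (n Γ)) → Vtx → Vtx
  combine f τ (v , a) = τ v , sum (λ i → label (f i (project i (v , a))))

  module _ {f : ∀ i → Vtxᵢ i → Vtxᵢ i} {τ : Fin (n Γ) → Fin (n Γ)}
           (f-isCoverMap : ∀ i → Covᵢ.IsCoverMap i (f i) τ) where
    open module fᵢ i = Covᵢ.IsCoverMap i (f-isCoverMap i)

    combine-isCoverMap : (∀ {u v} → T (adj Γ u v) → T (adj Γ (τ u) (τ v))) →
      Cov.IsCoverMap (combine f τ) τ
    combine-isCoverMap τ-adj = record
      { cong          = λ (u≡v , a≈b) → ≡.cong τ u≡v ,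
                          sum-cong-≋ (λ i → proj₂ (cong i (u≡v , q-cong i a≈b)))
      ; preserves-Adj = combined-adj
      ; over          = λ x → ≡.refl
      }
      where
      combined-adj : ∀ x y → SGraph.Adj (Cover Γ (rawA A) φ) x y →
        SGraph.Adj (Cover Γ (rawA A) φ) (combine f τ x) (combine f τ y)
      combined-adj (u , a) (v , b) (u~v , b≈φa) = τ-adj u~v , (begin
        sum fb                                   ≈⟨ sum-cong-≋ fb≈φfa ⟩
        sum (λ i → q i (φ (τ u) (τ v)) ∙ fa i)   ≈⟨ ∑-distrib-+ (λ i → q i (φ (τ u) (τ v))) fa ⟩
        sum (λ i → q i (φ (τ u) (τ v))) ∙ sum fa ≈⟨ ∙-congʳ (decomposition (φ (τ u) (τ v))) ⟨
        φ (τ u) (τ v) ∙ sum fa                   ∎)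
        where
        fa fb : Fin m → Carrier
        fa i = label (f i (project i (u , a)))
        fb i = label (f i (project i (v , b)))
        fb≈φfa : ∀ i → fb i ≈ q i (φ (τ u) (τ v)) ∙ fa i
        fb≈φfa i = trans
          (proj₂ (preserves-Adj i (project i (u , a)) (project i (v , b))
                    (u~v , trans (q-cong i b≈φa) (q-homo i (φ u v) a))))
          (∙-congʳ (q-cong i (reflexive (≡.cong₂ φ (over i _) (over i _)))))

    combine-inverse : ∀ {g τ′} → (∀ i → Covᵢ.IsCoverMap i (g i) τ′) →
      (∀ v → τ′ (τ v) ≡ v) → (∀ i y → g i (f i y) ≃ᵢ y) →
      ∀ x → combine g τ′ (combine f τ x) ≃ x
    combine-inverse {g} g-isCoverMap τ′∘τ g∘f (v , a) = τ′∘τ v , (begin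
      sum (λ i → label (g i (project i (τ v , sum fa))))  ≈⟨ sum-cong-≋ gfa≈ ⟩
      sum (λ i → q i a)                                   ≈⟨ decomposition a ⟨
      a                                                   ∎)
      where
      fa : Fin m → Carrier
      fa i = label (f i (project i (v , a)))
      gfa≈ : ∀ i → label (g i (project i (τ v , sum fa))) ≈ q i a
      gfa≈ i = trans
        (proj₂ (Covᵢ.IsCoverMap.cong (g-isCoverMap i)
                  (≡.sym (over i _) , q-sum fa (λ j → proj₂ (proj₂ (f j (project j (v , a))))) i)))
        (proj₂ (g∘f i (project i (v , a))))

  lift-from-sylows : ∀ {σ} → IsAut Γ σ →
    (∀ i → Lifts Γ σ (Sylow A (I i)) φ[ i ]) → Lifts Γ σ (rawA A) φ
  lift-from-sylows {σ} σ-aut Ls = Cov.InverseLifts⇒Lifts {σ} record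
    { lift              = combine lift (σ ⟨$⟩ʳ_)
    ; lift⁻¹            = combine lift⁻¹ (σ ⟨$⟩ˡ_)
    ; lift-isCoverMap   = combine-isCoverMap lift-isCoverMap (aut-preserves-adj {Γ} {σ} σ-aut)
    ; lift⁻¹-isCoverMap = combine-isCoverMap lift⁻¹-isCoverMap (aut⁻¹-preserves-adj {Γ} {σ} σ-aut)
    ; lift∘lift⁻¹       = combine-inverse lift⁻¹-isCoverMap lift-isCoverMap
                            (λ _ → Permutation.inverseʳ σ) lift∘lift⁻¹
    ; lift⁻¹∘lift       = combine-inverse lift-isCoverMap lift⁻¹-isCoverMap
                            (λ _ → Permutation.inverseˡ σ) lift⁻¹∘lift
    }
    where open module Lᵢ i = Covᵢ.InverseLifts i {σ} (Covᵢ.Lifts⇒InverseLifts i (Ls i))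

lemma3p3 : (Γ : Graph) → Connected Γ →
    (A : AbelianGroup 0ℓ 0ℓ) → IsFinite A →
    {m : ℕ} (I : Fin m → ℕ) (q : Fin m → AbelianGroup.Carrier A → AbelianGroup.Carrier A) →
    (dec : IsSylowDecomposition A I q) →
    (φ : Fin (n Γ) → Fin (n Γ) → AbelianGroup.Carrier A) →
    IsVoltage Γ (rawA A) φ →
    SConnected (Cover Γ (rawA A) φ) →
    (IsGraphIso (Cover Γ (rawA A) φ)
                (Cover Γ (ΠGroup (λ i → Sylow A (I i))) (λ u v i → sylowVoltage A dec φ i u v))
                (sylowIdentification A dec)
      × (∀ x → proj₁ (sylowIdentification A dec {Fin (n Γ)} x) ≡ proj₁ x))
    ×
    (∀ (σ : Permutation′ (n Γ)) → IsAut Γ σ →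
      (Lifts Γ σ (rawA A) φ ⇔ (∀ i → Lifts Γ σ (Sylow A (I i)) (sylowVoltage A dec φ i))))
lemma3p3 Γ _ A _ I q dec φ _ connected =
    (sylowIdentification-isGraphIso Γ φ , λ _ → ≡.refl)
  , λ σ σ-aut → mk⇔ (lift-to-sylow connected {σ}) (lift-from-sylows {σ} σ-aut)
  where
  open SylowDecomposition A I q dec using (sylowIdentification-isGraphIso)
  open SylowLifts A I q dec Γ φ using (lift-to-sylow; lift-from-sylows)
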